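{- Let $\mathcal{R}'=\{\beta,\mu,\mu',\rho,\varepsilon\}$, let $n\ge0$, let $N_1,\dots,N_n\in\mathcal{WN}_{\mathcal{R}'}\cap\mathcal{T}_t$ and let $x$ be a $\lambda$-variable. If $(x)N_1\dots N_n\in\mathcal{T}_t$, then $(x)N_1\dots N_n\in\mathcal{WN}_{\mathcal{R}'}\cap\mathcal{T}_t$.
   Context: $\lambda\mu$-terms: $\mathcal{T} ::= x \mid \lambda x.\mathcal{T} \mid (\mathcal{T})\mathcal{T} \mid [\alpha]\mathcal{T} \mid \mu\alpha.\mathcal{T}$, up to renaming of bound variables; substitutions avoid capture. $(x)N_1\dots N_n$ denotes $(\dots((x)N_1)\dots)N_n$. Types $A ::= X \mid \bot \mid A\to B$; typing judgments $\Gamma\vdash M:A;\Theta$ by: $\Gamma,x:A\vdash x:A;\Theta$; from $\Gamma,x:A\vdash M:B;\Theta$ infer $\Gamma\vdash\lambda x.M:A\to B;\Theta$; from $\Gamma\vdash M:A\to B;\Theta$, $\Gamma\vdash N:A;\Theta$ infer $\Gamma\vdash(M)N:B;\Theta$; from $\Gamma\vdash M:A;\alpha:A,\Theta$ infer $\Gamma\vdash[\alpha]M:\bot;\alpha:A,\Theta$; from $\Gamma\vdash M:\bot;\alpha:A,\Theta$ infer $\Gamma\vdash\mu\alpha.M:A;\Theta$. $\mathcal{T}_t$ = typable terms. $M[\alpha:=\beta]$ renaming; $M[\alpha:=_rN]$ (resp. $M[\alpha:=_lN]$) replaces inductively each $[\alpha]P$ by $[\alpha](P')N$ (resp. $[\alpha](N)P'$);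 $M_\alpha$ replaces inductively each $[\alpha]P$ by $P$. Rules: $\beta$: $(\lambda x.M)N\to M[x:=N]$; $\mu$: $(\mu\alpha.M)N\to\mu\alpha.M[\alpha:=_rN]$; $\mu'$: $(N)\mu\alpha.M\to\mu\alpha.M[\alpha:=_lN]$; $\rho$: $[\beta]\mu\alpha.M\to M[\alpha:=\beta]$; $\varepsilon$: $\mu\alpha.\mu\beta.M\to\mu\alpha.M_\beta$. $\mathcal{WN}_{\mathcal{R}'}$: terms reducing (one redex contracted per step, anywhere) to a term with no $\mathcal{R}'$-redex. -}

module Defs where

-- λμ-calculus with de Bruijn indices (terms up to α-renaming).
-- Two separate index spaces: λ-variables (var, ƛ) and μ-names ([α]M, μ).

open import Data.Nat using (ℕ; zero; suc; _≡ᵇ_)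
open import Data.Bool using (if_then_else_)
open import Data.List using (List; []; _∷_; foldl)
open import Data.Product using (Σ; ∃; _×_; _,_)
open import Relation.Nullary using (¬_)
open import Relation.Binary.Construct.Closure.ReflexiveTransitive using (Star)

infixl 7 _·_
infix 4 _↦_ _⟶_ _⟶*_

data Tm : Set where
  var  : ℕ → Tm
  ƛ    : Tm → Tm
  _·_  : Tm → Tm → Tm    -- (M)N
  nm   : ℕ → Tm → Tm     -- [α]M
  μ    : Tm → Tm         -- μα.M   (binds name-index 0)

data Ty : Set where
  atom : ℕ → Ty
  ⊥ty  : Ty
  _⇒_  : Ty → Ty → Ty

ext : (ℕ → ℕ) → ℕ → ℕ
ext f zero    = zero
ext f (suc n) = suc (f n)

renV : (ℕ → ℕ) → Tm → Tm
renV f (var x)  = var (f x)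
renV f (ƛ M)    = ƛ (renV (ext f) M)
renV f (M · N)  = renV f M · renV f N
renV f (nm a M) = nm a (renV f M)
renV f (μ M)    = μ (renV f M)

renN : (ℕ → ℕ) → Tm → Tm
renN f (var x)  = var x
renN f (ƛ M)    = ƛ (renN f M)
renN f (M · N)  = renN f M · renN f N
renN f (nm a M) = nm (f a) (renN f M)
renN f (μ M)    = μ (renN (ext f) M)

exts : (ℕ → Tm) → ℕ → Tm
exts σ zero    = var zero
exts σ (suc n) = renV suc (σ n)

subst : (ℕ → Tm) → Tm → Tm
subst σ (var x)  = σ x
subst σ (ƛ M)    = ƛ (subst (exts σ) M)
subst σ (M · N)  = subst σ M · subst σ N
subst σ (nm a M) = nm a (subst σ M)
subst σ (μ M)    = μ (subst (λ n → renN suc (σ n)) M)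

_[0:=_] : Tm → Tm → Tm
M [0:= N ] = subst σ M
  where
  σ : ℕ → Tm
  σ zero    = N
  σ (suc n) = var n

-- M[α :=_r N] : each [α]P becomes [α](P')N
substR : ℕ → Tm → Tm → Tm
substR α N (var x)  = var x
substR α N (ƛ M)    = ƛ (substR α (renV suc N) M)
substR α N (M · P)  = substR α N M · substR α N P
substR α N (nm b P) =
  if b ≡ᵇ α then nm b (substR α N P · N) else nm b (substR α N P)
substR α N (μ M)    = μ (substR (suc α) (renN suc N) M)

-- M[α :=_l N] : each [α]P becomes [α](N)P'
substL : ℕ → Tm → Tm → Tm
substL α N (var x)  = var x
substL α N (ƛ M)    = ƛ (substL α (renV suc N) M)
substL α N (M · P)  = substL α N M · substL α N P
substL α N (nm b P) =
  if b ≡ᵇ α then nm b (N · substL α N P) else nm b (substL α N P)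
substL α N (μ M)    = μ (substL (suc α) (renN suc N) M)

rhoRen : ℕ → ℕ → ℕ
rhoRen β zero    = β
rhoRen β (suc k) = k

-- removing the name index c from the index space (for indices ≠ c)
dropIx : ℕ → ℕ → ℕ
dropIx zero    zero    = zero
dropIx zero    (suc k) = k
dropIx (suc c) zero    = zero
dropIx (suc c) (suc k) = suc (dropIx c k)

-- M_β : each [β]P becomes P' (β = name index c), other names re-indexed
erase : ℕ → Tm → Tm
erase c (var x)  = var x
erase c (ƛ M)    = ƛ (erase c M)
erase c (M · P)  = erase c M · erase c P
erase c (nm b P) = if b ≡ᵇ c then erase c P else nm (dropIx c b) (erase c P)
erase c (μ M)    = μ (erase (suc c) M)

data _↦_ : Tm → Tm → Set where
  βr  : ∀ {M N} → (ƛ M) · N ↦ (M [0:= N ])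
  μr  : ∀ {M N} → (μ M) · N ↦ μ (substR zero (renN suc N) M)
  μ'r : ∀ {M N} → N · (μ M) ↦ μ (substL zero (renN suc N) M)
  ρr  : ∀ {β M} → nm β (μ M) ↦ renN (rhoRen β) M
  εr  : ∀ {M} → μ (μ M) ↦ μ (erase zero M)

data _⟶_ : Tm → Tm → Set where
  root : ∀ {M M'} → M ↦ M' → M ⟶ M'
  cƛ   : ∀ {M M'} → M ⟶ M' → ƛ M ⟶ ƛ M'
  c·l  : ∀ {M M' N} → M ⟶ M' → M · N ⟶ M' · N
  c·r  : ∀ {M N N'} → N ⟶ N' → M · N ⟶ M · N'
  cnm  : ∀ {a M M'} → M ⟶ M' → nm a M ⟶ nm a M'
  cμ   : ∀ {M M'} → M ⟶ M' → μ M ⟶ μ M'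

_⟶*_ : Tm → Tm → Set
_⟶*_ = Star _⟶_

data IsRedex : Tm → Set where
  βx  : ∀ {M N} → IsRedex ((ƛ M) · N)
  μx  : ∀ {M N} → IsRedex ((μ M) · N)
  μ'x : ∀ {M N} → IsRedex (N · (μ M))
  ρx  : ∀ {β M} → IsRedex (nm β (μ M))
  εx  : ∀ {M} → IsRedex (μ (μ M))

data HasRedex : Tm → Set where
  here : ∀ {M} → IsRedex M → HasRedex M
  inƛ  : ∀ {M} → HasRedex M → HasRedex (ƛ M)
  in·l : ∀ {M N} → HasRedex M → HasRedex (M · N)
  in·r : ∀ {M N} → HasRedex N → HasRedex (M · N)
  innm : ∀ {a M} → HasRedex M → HasRedex (nm a M)
  inμ  : ∀ {M} → HasRedex M → HasRedex (μ M)

Normal : Tm → Set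
Normal M = ¬ HasRedex M

WN : Tm → Set
WN M = ∃ λ M' → (M ⟶* M') × Normal M'

data _∋_∶_ : List Ty → ℕ → Ty → Set where
  here  : ∀ {Γ A} → (A ∷ Γ) ∋ zero ∶ A
  there : ∀ {Γ A B n} → Γ ∋ n ∶ A → (B ∷ Γ) ∋ suc n ∶ A

data _⊢_∶_∣_ : List Ty → Tm → Ty → List Ty → Set where
  ax  : ∀ {Γ Θ x A} → Γ ∋ x ∶ A → Γ ⊢ var x ∶ A ∣ Θ
  lam : ∀ {Γ Θ M A B} → (A ∷ Γ) ⊢ M ∶ B ∣ Θ → Γ ⊢ ƛ M ∶ (A ⇒ B) ∣ Θ
  app : ∀ {Γ Θ M N A B} → Γ ⊢ M ∶ (A ⇒ B) ∣ Θ → Γ ⊢ N ∶ A ∣ Θ → Γ ⊢ M · N ∶ B ∣ Θ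
  nam : ∀ {Γ Θ M α A} → Θ ∋ α ∶ A → Γ ⊢ M ∶ A ∣ Θ → Γ ⊢ nm α M ∶ ⊥ty ∣ Θ
  mu  : ∀ {Γ Θ M A} → Γ ⊢ M ∶ ⊥ty ∣ (A ∷ Θ) → Γ ⊢ μ M ∶ A ∣ Θ

Typable : Tm → Set
Typable M = Σ (List Ty) λ Γ → Σ (List Ty) λ Θ → Σ Ty λ A → Γ ⊢ M ∶ A ∣ Θ

apps : Tm → List Tm → Tm
apps = foldl _·_

-- Normalise the arguments first, then absorb them into the head one at a time, keeping the
-- head in one of two normal shapes: a neutral term (x)P₁…Pₖ, or μα.M with M normal and P
-- neutral in every [α]P of M.  Applying a neutral head to μβ.R fires μ' once.  Applying
-- μα.M to a normal N fires μ, turning each [α]P into [α](P)N: this is normal unless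
-- N = μβ.R, and then one μ' and one ρ step make it normal again.  Typability is used only to
-- know that no [β]P stands in function position, so that a ρ-contractum creates no redex.
module Submission where

open import Defs
open import Data.Nat using (ℕ; zero; suc; _≡ᵇ_; _≟_)
open import Data.Bool using (true; false; if_then_else_)
open import Data.List using (List; []; _∷_)
open import Data.List.Relation.Unary.All using (All; []; _∷_)
import Data.List.Relation.Unary.All as All
open import Data.Product using (_×_; _,_; ∃; proj₁; uncurry)
open import Data.Empty using (⊥-elim)
open import Function using (_∘_)
open import Relation.Nullary using (proof; ofʸ; ofⁿ)
open import Relation.Binary.PropositionalEquality using (_≡_; _≢_; refl; sym; trans; cong)
open import Relation.Binary.Construct.Closure.ReflexiveTransitive using (ε; _◅_; _◅◅_; gmap)

data Former : Set where
  `var `ƛ `app `nm `μ : Former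

former : Tm → Former
former (var _)  = `var
former (ƛ _)    = `ƛ
former (_ · _)  = `app
former (nm _ _) = `nm
former (μ _)    = `μ

former-≢ : ∀ {X Y k} → former X ≡ former Y → former Y ≢ k → former X ≢ k
former-≢ e p = p ∘ trans (sym e)

former-renV : ∀ f M → former (renV f M) ≡ former M
former-renV f (var _)  = refl
former-renV f (ƛ _)    = refl
former-renV f (_ · _)  = refl
former-renV f (nm _ _) = refl
former-renV f (μ _)    = refl

former-renN : ∀ f M → former (renN f M) ≡ former M
former-renN f (var _)  = refl
former-renN f (ƛ _)    = refl
former-renN f (_ · _)  = refl
former-renN f (nm _ _) = refl
former-renN f (μ _)    = refl

former-substL : ∀ α Q M → former (substL α Q M) ≡ former M
former-substL α Q (var _)  = refl
former-substL α Q (ƛ _)    = refl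
former-substL α Q (_ · _)  = refl
former-substL α Q (nm b _) with b ≡ᵇ α
... | true  = refl
... | false = refl
former-substL α Q (μ _)    = refl

data MuView : Tm → Set where
  isμ  : ∀ R → MuView (μ R)
  notμ : ∀ {N} → former N ≢ `μ → MuView N

muView : ∀ N → MuView N
muView (var _)  = notμ λ ()
muView (ƛ _)    = notμ λ ()
muView (_ · _)  = notμ λ ()
muView (nm _ _) = notμ λ ()
muView (μ R)    = isμ R

former≢μ : ∀ M → (∀ {R} → M ≢ μ R) → former M ≢ `μ
former≢μ M M≢μ with muView M
... | isμ R    = ⊥-elim (M≢μ refl)
... | notμ ¬μ  = ¬μ

former≢ƛ : ∀ M → (∀ {R} → M ≢ ƛ R) → former M ≢ `ƛ
former≢ƛ (ƛ R)    M≢ƛ = ⊥-elim (M≢ƛ refl)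
former≢ƛ (var _)  M≢ƛ = λ ()
former≢ƛ (_ · _)  M≢ƛ = λ ()
former≢ƛ (nm _ _) M≢ƛ = λ ()
former≢ƛ (μ _)    M≢ƛ = λ ()

-- Normal and neutral terms

data Nf : Tm → Set where
  nvar : ∀ {x} → Nf (var x)
  nƛ   : ∀ {M} → Nf M → Nf (ƛ M)
  n·   : ∀ {M N} → Nf M → Nf N →
         former M ≢ `ƛ → former M ≢ `μ → former N ≢ `μ → Nf (M · N)
  nnm  : ∀ {a M} → Nf M → former M ≢ `μ → Nf (nm a M)
  nμ   : ∀ {M} → Nf M → former M ≢ `μ → Nf (μ M)

Nf⇒Normal : ∀ {M} → Nf M → Normal M
Nf⇒Normal nvar               (here ())
Nf⇒Normal (nƛ n)             (here ())
Nf⇒Normal (nƛ n)             (inƛ r)     = Nf⇒Normal n r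
Nf⇒Normal (n· _ _ ¬ƛ _ _)    (here βx)   = ¬ƛ refl
Nf⇒Normal (n· _ _ _ ¬μ _)    (here μx)   = ¬μ refl
Nf⇒Normal (n· _ _ _ _ ¬μ)    (here μ'x)  = ¬μ refl
Nf⇒Normal (n· m _ _ _ _)     (in·l r)    = Nf⇒Normal m r
Nf⇒Normal (n· _ n _ _ _)     (in·r r)    = Nf⇒Normal n r
Nf⇒Normal (nnm _ ¬μ)         (here ρx)   = ¬μ refl
Nf⇒Normal (nnm n _)          (innm r)    = Nf⇒Normal n r
Nf⇒Normal (nμ _ ¬μ)          (here εx)   = ¬μ refl
Nf⇒Normal (nμ n _)           (inμ r)     = Nf⇒Normal n r

Normal⇒Nf : ∀ M → Normal M → Nf M
Normal⇒Nf (var _)  nf = nvar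
Normal⇒Nf (ƛ M)    nf = nƛ (Normal⇒Nf M (nf ∘ inƛ))
Normal⇒Nf (M · N)  nf =
  n· (Normal⇒Nf M (nf ∘ in·l)) (Normal⇒Nf N (nf ∘ in·r))
     (former≢ƛ M λ { refl → nf (here βx) })
     (former≢μ M λ { refl → nf (here μx) })
     (former≢μ N λ { refl → nf (here μ'x) })
Normal⇒Nf (nm a M) nf = nnm (Normal⇒Nf M (nf ∘ innm)) (former≢μ M λ { refl → nf (here ρx) })
Normal⇒Nf (μ M)    nf = nμ (Normal⇒Nf M (nf ∘ inμ)) (former≢μ M λ { refl → nf (here εx) })

data Ne : Tm → Set where
  nevar : ∀ {x} → Ne (var x)
  ne·   : ∀ {H N} → Ne H → Nf N → former N ≢ `μ → Ne (H · N)

Ne-¬ƛ : ∀ {H} → Ne H → former H ≢ `ƛ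
Ne-¬ƛ nevar        ()
Ne-¬ƛ (ne· _ _ _)  ()

Ne-¬μ : ∀ {H} → Ne H → former H ≢ `μ
Ne-¬μ nevar        ()
Ne-¬μ (ne· _ _ _)  ()

Ne-¬nm : ∀ {H} → Ne H → former H ≢ `nm
Ne-¬nm nevar       ()
Ne-¬nm (ne· _ _ _) ()

Ne⇒Nf : ∀ {H} → Ne H → Nf H
Ne⇒Nf nevar        = nvar
Ne⇒Nf (ne· h n ¬μ) = n· (Ne⇒Nf h) n (Ne-¬ƛ h) (Ne-¬μ h) ¬μ

Nf-nm-Ne : ∀ {a P} → Ne P → Nf (nm a P)
Nf-nm-Ne p = nnm (Ne⇒Nf p) (Ne-¬μ p)

Nf-renV : ∀ f {M} → Nf M → Nf (renV f M)
Nf-renV f nvar                        = nvar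
Nf-renV f (nƛ n)                      = nƛ (Nf-renV (ext f) n)
Nf-renV f (n· {M} {N} m n ¬ƛ ¬μ ¬μ') =
  n· (Nf-renV f m) (Nf-renV f n) (former-≢ (former-renV f M) ¬ƛ)
     (former-≢ (former-renV f M) ¬μ) (former-≢ (former-renV f N) ¬μ')
Nf-renV f (nnm {M = M} n ¬μ)          = nnm (Nf-renV f n) (former-≢ (former-renV f M) ¬μ)
Nf-renV f (nμ {M} n ¬μ)               = nμ (Nf-renV f n) (former-≢ (former-renV f M) ¬μ)

Nf-renN : ∀ f {M} → Nf M → Nf (renN f M)
Nf-renN f nvar                        = nvar
Nf-renN f (nƛ n)                      = nƛ (Nf-renN f n)
Nf-renN f (n· {M} {N} m n ¬ƛ ¬μ ¬μ') =
  n· (Nf-renN f m) (Nf-renN f n) (former-≢ (former-renN f M) ¬ƛ)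
     (former-≢ (former-renN f M) ¬μ) (former-≢ (former-renN f N) ¬μ')
Nf-renN f (nnm {M = M} n ¬μ)          = nnm (Nf-renN f n) (former-≢ (former-renN f M) ¬μ)
Nf-renN f (nμ {M} n ¬μ)               = nμ (Nf-renN (ext f) n) (former-≢ (former-renN (ext f) M) ¬μ)

Ne-renV : ∀ f {M} → Ne M → Ne (renV f M)
Ne-renV f nevar                = nevar
Ne-renV f (ne· {N = N} h n ¬μ) = ne· (Ne-renV f h) (Nf-renV f n) (former-≢ (former-renV f N) ¬μ)

Ne-renN : ∀ f {M} → Ne M → Ne (renN f M)
Ne-renN f nevar                = nevar
Ne-renN f (ne· {N = N} h n ¬μ) = ne· (Ne-renN f h) (Nf-renN f n) (former-≢ (former-renN f N) ¬μ)

-- Invariants of the normal forms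

data NamedNotApplied : Tm → Set where
  avar : ∀ {x} → NamedNotApplied (var x)
  aƛ   : ∀ {M} → NamedNotApplied M → NamedNotApplied (ƛ M)
  a·   : ∀ {M N} → NamedNotApplied M → NamedNotApplied N → former M ≢ `nm →
         NamedNotApplied (M · N)
  anm  : ∀ {a M} → NamedNotApplied M → NamedNotApplied (nm a M)
  aμ   : ∀ {M} → NamedNotApplied M → NamedNotApplied (μ M)

NamedNotApplied-renV : ∀ f {M} → NamedNotApplied M → NamedNotApplied (renV f M)
NamedNotApplied-renV f avar              = avar
NamedNotApplied-renV f (aƛ o)            = aƛ (NamedNotApplied-renV (ext f) o)
NamedNotApplied-renV f (a· {M} o p ¬nm)  =
  a· (NamedNotApplied-renV f o) (NamedNotApplied-renV f p) (former-≢ (former-renV f M) ¬nm)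
NamedNotApplied-renV f (anm o)           = anm (NamedNotApplied-renV f o)
NamedNotApplied-renV f (aμ o)            = aμ (NamedNotApplied-renV f o)

NamedNotApplied-renN : ∀ f {M} → NamedNotApplied M → NamedNotApplied (renN f M)
NamedNotApplied-renN f avar              = avar
NamedNotApplied-renN f (aƛ o)            = aƛ (NamedNotApplied-renN f o)
NamedNotApplied-renN f (a· {M} o p ¬nm)  =
  a· (NamedNotApplied-renN f o) (NamedNotApplied-renN f p) (former-≢ (former-renN f M) ¬nm)
NamedNotApplied-renN f (anm o)           = anm (NamedNotApplied-renN f o)
NamedNotApplied-renN f (aμ o)            = aμ (NamedNotApplied-renN (ext f) o)

data NamedNeutral : ℕ → Tm → Set where
  gvar : ∀ {α x} → NamedNeutral α (var x)
  gƛ   : ∀ {α M} → NamedNeutral α M → NamedNeutral α (ƛ M)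
  g·   : ∀ {α M N} → NamedNeutral α M → NamedNeutral α N → NamedNeutral α (M · N)
  gnm  : ∀ {α b P} → (b ≡ α → Ne P) → NamedNeutral α P → NamedNeutral α (nm b P)
  gμ   : ∀ {α M} → NamedNeutral (suc α) M → NamedNeutral α (μ M)

gƛ⁻¹ : ∀ {α M} → NamedNeutral α (ƛ M) → NamedNeutral α M
gƛ⁻¹ (gƛ g) = g

g·⁻¹ˡ : ∀ {α M N} → NamedNeutral α (M · N) → NamedNeutral α M
g·⁻¹ˡ (g· g _) = g

g·⁻¹ʳ : ∀ {α M N} → NamedNeutral α (M · N) → NamedNeutral α N
g·⁻¹ʳ (g· _ g) = g

gnm⁻¹ : ∀ {α b P} → NamedNeutral α (nm b P) → NamedNeutral α P
gnm⁻¹ (gnm _ g) = g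

gnm-Ne : ∀ {b P} → NamedNeutral b (nm b P) → Ne P
gnm-Ne (gnm h _) = h refl

gμ⁻¹ : ∀ {α M} → NamedNeutral α (μ M) → NamedNeutral (suc α) M
gμ⁻¹ (gμ g) = g

NamedNeutral-renV : ∀ f {α M} → NamedNeutral α M → NamedNeutral α (renV f M)
NamedNeutral-renV f gvar      = gvar
NamedNeutral-renV f (gƛ g)    = gƛ (NamedNeutral-renV (ext f) g)
NamedNeutral-renV f (g· g h)  = g· (NamedNeutral-renV f g) (NamedNeutral-renV f h)
NamedNeutral-renV f (gnm h g) = gnm (Ne-renV f ∘ h) (NamedNeutral-renV f g)
NamedNeutral-renV f (gμ g)    = gμ (NamedNeutral-renV f g)

NamedNeutral-renN : ∀ f β X → (∀ a → f a ≡ β → NamedNeutral a X) → NamedNeutral β (renN f X)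
NamedNeutral-renN f β (var _)  h = gvar
NamedNeutral-renN f β (ƛ X)    h = gƛ (NamedNeutral-renN f β X λ a e → gƛ⁻¹ (h a e))
NamedNeutral-renN f β (X · Y)  h =
  g· (NamedNeutral-renN f β X λ a e → g·⁻¹ˡ (h a e))
     (NamedNeutral-renN f β Y λ a e → g·⁻¹ʳ (h a e))
NamedNeutral-renN f β (nm b P) h =
  gnm (λ e → Ne-renN f (gnm-Ne (h b e))) (NamedNeutral-renN f β P λ a e → gnm⁻¹ (h a e))
NamedNeutral-renN f β (μ X)    h = gμ (NamedNeutral-renN (ext f) (suc β) X ext-preimage)
  where
  ext-preimage : ∀ a → ext f a ≡ suc β → NamedNeutral a X
  ext-preimage (suc a) refl = gμ⁻¹ (h a refl)

NamedNeutral-renN-suc : ∀ {α Q} → NamedNeutral α Q → NamedNeutral (suc α) (renN suc Q)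
NamedNeutral-renN-suc {α} {Q} g = NamedNeutral-renN suc (suc α) Q λ { _ refl → g }

NamedNeutral-fresh : ∀ Q → NamedNeutral zero (renN suc Q)
NamedNeutral-fresh Q = NamedNeutral-renN suc zero Q λ _ ()

NfAt : ℕ → Tm → Set
NfAt α M = Nf M × NamedNotApplied M × NamedNeutral α M

NfAt-renV : ∀ {α N} → NfAt α N → NfAt α (renV suc N)
NfAt-renV (n , o , g) = Nf-renV suc n , NamedNotApplied-renV suc o , NamedNeutral-renV suc g

NfAt-renN-suc : ∀ {α N} → NfAt α N → NfAt (suc α) (renN suc N)
NfAt-renN-suc (n , o , g) = Nf-renN suc n , NamedNotApplied-renN suc o , NamedNeutral-renN-suc g

NfAt-fresh : ∀ {N} → Nf N → NamedNotApplied N → NfAt zero (renN suc N)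
NfAt-fresh {N} n o = Nf-renN suc n , NamedNotApplied-renN suc o , NamedNeutral-fresh N

-- Left μ-substitution of a neutral term

Nf-substL : ∀ α Q R → Ne Q → Nf R → Nf (substL α Q R)
Nf-substL α Q (var _)  q nvar   = nvar
Nf-substL α Q (ƛ R)    q (nƛ n) = nƛ (Nf-substL α (renV suc Q) R (Ne-renV suc q) n)
Nf-substL α Q (M · P)  q (n· m p ¬ƛ ¬μ ¬μ') =
  n· (Nf-substL α Q M q m) (Nf-substL α Q P q p) (former-≢ (former-substL α Q M) ¬ƛ)
     (former-≢ (former-substL α Q M) ¬μ) (former-≢ (former-substL α Q P) ¬μ')
Nf-substL α Q (nm b P) q (nnm p ¬μ) with b ≡ᵇ α
... | true  = Nf-nm-Ne (ne· q (Nf-substL α Q P q p) (former-≢ (former-substL α Q P) ¬μ))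
... | false = nnm (Nf-substL α Q P q p) (former-≢ (former-substL α Q P) ¬μ)
Nf-substL α Q (μ R)    q (nμ n ¬μ) =
  nμ (Nf-substL (suc α) (renN suc Q) R (Ne-renN suc q) n)
     (former-≢ (former-substL (suc α) (renN suc Q) R) ¬μ)

Ne-substL : ∀ α Q S → Ne Q → Ne S → Ne (substL α Q S)
Ne-substL α Q (var _) q nevar        = nevar
Ne-substL α Q (H · N) q (ne· h n ¬μ) =
  ne· (Ne-substL α Q H q h) (Nf-substL α Q N q n) (former-≢ (former-substL α Q N) ¬μ)

NamedNotApplied-substL : ∀ α Q R → Ne Q → NamedNotApplied Q → NamedNotApplied R →
  NamedNotApplied (substL α Q R)
NamedNotApplied-substL α Q (var _)  q oq avar   = avar
NamedNotApplied-substL α Q (ƛ R)    q oq (aƛ o) =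
  aƛ (NamedNotApplied-substL α (renV suc Q) R (Ne-renV suc q) (NamedNotApplied-renV suc oq) o)
NamedNotApplied-substL α Q (M · P)  q oq (a· o p ¬nm) =
  a· (NamedNotApplied-substL α Q M q oq o) (NamedNotApplied-substL α Q P q oq p)
     (former-≢ (former-substL α Q M) ¬nm)
NamedNotApplied-substL α Q (nm b P) q oq (anm o) with b ≡ᵇ α
... | true  = anm (a· oq (NamedNotApplied-substL α Q P q oq o) (Ne-¬nm q))
... | false = anm (NamedNotApplied-substL α Q P q oq o)
NamedNotApplied-substL α Q (μ R)    q oq (aμ o) =
  aμ (NamedNotApplied-substL (suc α) (renN suc Q) R (Ne-renN suc q) (NamedNotApplied-renN suc oq) o)

NamedNeutral-substL : ∀ α β Q R → Ne Q → NamedNeutral β Q → Nf R → NamedNeutral β R →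
  NamedNeutral β (substL α Q R)
NamedNeutral-substL α β Q (var _)  q gq nvar                gvar     = gvar
NamedNeutral-substL α β Q (ƛ R)    q gq (nƛ n)              (gƛ g)   =
  gƛ (NamedNeutral-substL α β (renV suc Q) R (Ne-renV suc q) (NamedNeutral-renV suc gq) n g)
NamedNeutral-substL α β Q (M · P)  q gq (n· m p _ _ _)      (g· g h) =
  g· (NamedNeutral-substL α β Q M q gq m g) (NamedNeutral-substL α β Q P q gq p h)
NamedNeutral-substL α β Q (nm b P) q gq (nnm p ¬μ)          (gnm h g) with b ≡ᵇ α
... | true  = gnm (λ _ → ne· q (Nf-substL α Q P q p) (former-≢ (former-substL α Q P) ¬μ))
                  (g· gq (NamedNeutral-substL α β Q P q gq p g))
... | false = gnm (Ne-substL α Q P q ∘ h) (NamedNeutral-substL α β Q P q gq p g)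
NamedNeutral-substL α β Q (μ R)    q gq (nμ n _)            (gμ g)   =
  gμ (NamedNeutral-substL (suc α) (suc β) (renN suc Q) R (Ne-renN suc q)
                          (NamedNeutral-renN-suc gq) n g)

NamedNeutral-substL-self : ∀ α Q R → Ne Q → NamedNeutral α Q → Nf R →
  NamedNeutral α (substL α Q R)
NamedNeutral-substL-self α Q (var _)  q gq nvar           = gvar
NamedNeutral-substL-self α Q (ƛ R)    q gq (nƛ n)         =
  gƛ (NamedNeutral-substL-self α (renV suc Q) R (Ne-renV suc q) (NamedNeutral-renV suc gq) n)
NamedNeutral-substL-self α Q (M · P)  q gq (n· m p _ _ _) =
  g· (NamedNeutral-substL-self α Q M q gq m) (NamedNeutral-substL-self α Q P q gq p)
NamedNeutral-substL-self α Q (nm b P) q gq (nnm p ¬μ) with b ≡ᵇ α | proof (b ≟ α)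
... | false | ofⁿ b≢α = gnm (⊥-elim ∘ b≢α) (NamedNeutral-substL-self α Q P q gq p)
... | true  | ofʸ refl =
  gnm (λ _ → ne· q (Nf-substL α Q P q p) (former-≢ (former-substL α Q P) ¬μ))
      (g· gq (NamedNeutral-substL-self α Q P q gq p))
NamedNeutral-substL-self α Q (μ R)    q gq (nμ n _)       =
  gμ (NamedNeutral-substL-self (suc α) (renN suc Q) R (Ne-renN suc q) (NamedNeutral-renN-suc gq) n)

substL-NfAt : ∀ α Q R → Ne Q → NamedNotApplied Q → NamedNeutral α Q →
  Nf R → NamedNotApplied R → NfAt α (substL α Q R)
substL-NfAt α Q R q oq gq n o =
  Nf-substL α Q R q n , NamedNotApplied-substL α Q R q oq o , NamedNeutral-substL-self α Q R q gq n

-- Normal form of right μ-substitution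

nameApp : ℕ → Tm → Tm → Tm
nameApp b Q N with muView N
... | isμ R  = renN (rhoRen b) (substL zero (renN suc Q) R)
... | notμ _ = nm b (Q · N)

substRNf : ℕ → Tm → Tm → Tm
substRNf α N (var x)  = var x
substRNf α N (ƛ M)    = ƛ (substRNf α (renV suc N) M)
substRNf α N (M · P)  = substRNf α N M · substRNf α N P
substRNf α N (nm b P) = if b ≡ᵇ α then nameApp b (substRNf α N P) N else nm b (substRNf α N P)
substRNf α N (μ M)    = μ (substRNf (suc α) (renN suc N) M)

nameApp-reduces : ∀ b Q N → nm b (Q · N) ⟶* nameApp b Q N
nameApp-reduces b Q N with muView N
... | isμ R  = cnm (root μ'r) ◅ root ρr ◅ ε
... | notμ _ = ε

substR⟶*substRNf : ∀ α N M → substR α N M ⟶* substRNf α N M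
substR⟶*substRNf α N (var _)  = ε
substR⟶*substRNf α N (ƛ M)    = gmap ƛ cƛ (substR⟶*substRNf α (renV suc N) M)
substR⟶*substRNf α N (M · P)  =
  gmap (_· substR α N P) c·l (substR⟶*substRNf α N M) ◅◅
  gmap (substRNf α N M ·_) c·r (substR⟶*substRNf α N P)
substR⟶*substRNf α N (nm b P) with b ≡ᵇ α
... | true  = gmap (λ X → nm b (X · N)) (cnm ∘ c·l) (substR⟶*substRNf α N P) ◅◅
              nameApp-reduces b (substRNf α N P) N
... | false = gmap (nm b) cnm (substR⟶*substRNf α N P)
substR⟶*substRNf α N (μ M)    = gmap μ cμ (substR⟶*substRNf (suc α) (renN suc N) M)

former-substRNf : ∀ α N M → former M ≢ `nm → former (substRNf α N M) ≡ former M
former-substRNf α N (var _)  _   = refl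
former-substRNf α N (ƛ _)    _   = refl
former-substRNf α N (_ · _)  _   = refl
former-substRNf α N (nm _ _) ¬nm = ⊥-elim (¬nm refl)
former-substRNf α N (μ _)    _   = refl

nameApp-¬μ : ∀ b Q N → Nf N → former (nameApp b Q N) ≢ `μ
nameApp-¬μ b Q N n with muView N
nameApp-¬μ b Q .(μ R) (nμ _ ¬μ) | isμ R =
  former-≢ (trans (former-renN (rhoRen b) _) (former-substL zero (renN suc Q) R)) ¬μ
... | notμ _ = λ ()

substRNf-¬μ : ∀ α N M → Nf N → former M ≢ `μ → former (substRNf α N M) ≢ `μ
substRNf-¬μ α N (var _)  _ _  = λ ()
substRNf-¬μ α N (ƛ _)    _ _  = λ ()
substRNf-¬μ α N (_ · _)  _ _  = λ ()
substRNf-¬μ α N (nm b P) n _ with b ≡ᵇ α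
... | true  = nameApp-¬μ b (substRNf α N P) N n
... | false = λ ()
substRNf-¬μ α N (μ _)    _ ¬μ = ⊥-elim (¬μ refl)

nameApp-NfAt : ∀ α Q N → Ne Q → NamedNotApplied Q → NamedNeutral α Q → NfAt α N →
  NfAt α (nameApp α Q N)
nameApp-NfAt α Q N q oq gq nN with muView N
nameApp-NfAt α Q .(μ R) q oq gq (nμ nR _ , aμ oR , gμ gR) | isμ R
  with substL-NfAt zero (renN suc Q) R (Ne-renN suc q) (NamedNotApplied-renN suc oq)
                   (NamedNeutral-fresh Q) nR oR
... | nX , oX , g₀ =
  Nf-renN (rhoRen α) nX , NamedNotApplied-renN (rhoRen α) oX ,
  NamedNeutral-renN (rhoRen α) α _ preimage
  where
  -- the names sent to α by rhoRen α are the μ-bound 0 and α itself, seen under the binder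
  preimage : ∀ a → rhoRen α a ≡ α → NamedNeutral a (substL zero (renN suc Q) R)
  preimage zero    _    = g₀
  preimage (suc a) refl =
    NamedNeutral-substL zero (suc a) (renN suc Q) R (Ne-renN suc q) (NamedNeutral-renN-suc gq) nR gR
nameApp-NfAt α Q N q oq gq (n , o , g) | notμ ¬μ =
  Nf-nm-Ne (ne· q n ¬μ) , anm (a· oq o (Ne-¬nm q)) , gnm (λ _ → ne· q n ¬μ) (g· gq g)

mutual
  substRNf-NfAt : ∀ α N M → NfAt α N → NfAt α M → NfAt α (substRNf α N M)
  substRNf-NfAt α N (var _) _ _ = nvar , avar , gvar
  substRNf-NfAt α N (ƛ M) nN (nƛ n , aƛ o , gƛ g)
    with substRNf-NfAt α (renV suc N) M (NfAt-renV nN) (n , o , g)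
  ... | n' , o' , g' = nƛ n' , aƛ o' , gƛ g'
  substRNf-NfAt α N (M · P) nN (n· nM nP ¬ƛ ¬μ ¬μ' , a· oM oP ¬nm , g· gM gP)
    with substRNf-NfAt α N M nN (nM , oM , gM) | substRNf-NfAt α N P nN (nP , oP , gP)
  ... | nM' , oM' , gM' | nP' , oP' , gP' =
    n· nM' nP' (former-≢ M-former ¬ƛ) (former-≢ M-former ¬μ) (substRNf-¬μ α N P (proj₁ nN) ¬μ') ,
    a· oM' oP' (former-≢ M-former ¬nm) , g· gM' gP'
    where
    M-former : former (substRNf α N M) ≡ former M
    M-former = former-substRNf α N M ¬nm
  substRNf-NfAt α N (nm b P) nN (nnm nP ¬μ , anm oP , gnm h gP)
    with b ≡ᵇ α | proof (b ≟ α) | substRNf-NfAt α N P nN (nP , oP , gP)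
  ... | false | ofⁿ b≢α | nP' , oP' , gP' =
    nnm nP' (substRNf-¬μ α N P (proj₁ nN) ¬μ) , anm oP' , gnm (⊥-elim ∘ b≢α) gP'
  ... | true  | ofʸ refl | _ , oP' , gP' =
    nameApp-NfAt α (substRNf α N P) N (substRNf-Ne α N P nN (h refl) oP gP) oP' gP' nN
  substRNf-NfAt α N (μ M) nN (nμ n ¬μ , aμ o , gμ g)
    with substRNf-NfAt (suc α) (renN suc N) M (NfAt-renN-suc nN) (n , o , g)
  ... | n' , o' , g' =
    nμ n' (substRNf-¬μ (suc α) (renN suc N) M (Nf-renN suc (proj₁ nN)) ¬μ) , aμ o' , gμ g'

  substRNf-Ne : ∀ α N Q → NfAt α N → Ne Q → NamedNotApplied Q → NamedNeutral α Q →
    Ne (substRNf α N Q)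
  substRNf-Ne α N (var _) _  nevar        _            _         = nevar
  substRNf-Ne α N (H · X) nN (ne· h n ¬μ) (a· oH oX _) (g· gH gX) =
    ne· (substRNf-Ne α N H nN h oH gH) (proj₁ (substRNf-NfAt α N X nN (n , oX , gX)))
        (substRNf-¬μ α N X (proj₁ nN) ¬μ)

-- Absorbing normal arguments into the head

data HeadNf : Tm → Set where
  neutral : ∀ {T} → Ne T → NamedNotApplied T → HeadNf T
  μ-head  : ∀ {M} → NfAt zero M → former M ≢ `μ → HeadNf (μ M)

HeadNf⇒Nf : ∀ {T} → HeadNf T → Nf T
HeadNf⇒Nf (neutral h _)          = Ne⇒Nf h
HeadNf⇒Nf (μ-head (n , _ , _) ¬μ) = nμ n ¬μ

HeadNf-app : ∀ {T N} → HeadNf T → Nf N → NamedNotApplied N →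
  ∃ λ T' → (T · N ⟶* T') × HeadNf T'
HeadNf-app {T} {N} (neutral h oh) n o with muView N
HeadNf-app {T} {.(μ R)} (neutral h oh) (nμ nR ¬μ) (aμ oR) | isμ R =
  μ (substL zero (renN suc T) R) , root μ'r ◅ ε ,
  μ-head (substL-NfAt zero (renN suc T) R (Ne-renN suc h) (NamedNotApplied-renN suc oh)
                      (NamedNeutral-fresh T) nR oR)
         (former-≢ (former-substL zero (renN suc T) R) ¬μ)
... | notμ ¬μ = T · N , ε , neutral (ne· h n ¬μ) (a· oh o (Ne-¬nm h))
HeadNf-app {μ M} {N} (μ-head nM ¬μ) n o =
  μ (substRNf zero (renN suc N) M) ,
  root μr ◅ gmap μ cμ (substR⟶*substRNf zero (renN suc N) M) ,
  μ-head (substRNf-NfAt zero (renN suc N) M (NfAt-fresh n o) nM)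
         (substRNf-¬μ zero (renN suc N) M (Nf-renN suc n) ¬μ)

ReducesToNf : Tm → Set
ReducesToNf N = ∃ λ N' → (N ⟶* N') × Nf N' × NamedNotApplied N'

apps-cong : ∀ Ns {T T'} → T ⟶ T' → apps T Ns ⟶ apps T' Ns
apps-cong []       s = s
apps-cong (N ∷ Ns) s = apps-cong Ns (c·l s)

HeadNf-apps : ∀ {T Ns} → HeadNf T → All ReducesToNf Ns → ∃ λ T' → (apps T Ns ⟶* T') × Nf T'
HeadNf-apps {T} h [] = T , ε , HeadNf⇒Nf h
HeadNf-apps {T} {N ∷ Ns} h ((N' , N⟶*N' , n , o) ∷ rest) with HeadNf-app h n o
... | T₁ , T·N'⟶*T₁ , h₁ with HeadNf-apps h₁ rest
... | T₂ , T₁Ns⟶*T₂ , nf =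
  T₂ , gmap (λ X → apps X Ns) (apps-cong Ns) (gmap (T ·_) c·r N⟶*N' ◅◅ T·N'⟶*T₁) ◅◅ T₁Ns⟶*T₂ , nf

-- Subject reduction

∋-functional : ∀ {Θ k A B} → Θ ∋ k ∶ A → Θ ∋ k ∶ B → A ≡ B
∋-functional here      here      = refl
∋-functional (there a) (there b) = ∋-functional a b

Ren : (ℕ → ℕ) → List Ty → List Ty → Set
Ren f Γ Δ = ∀ {x B} → Γ ∋ x ∶ B → Δ ∋ f x ∶ B

Ren-ext : ∀ {f Γ Δ C} → Ren f Γ Δ → Ren (ext f) (C ∷ Γ) (C ∷ Δ)
Ren-ext h here      = here
Ren-ext h (there x) = there (h x)

Ren-rhoRen : ∀ {Θ β A} → Θ ∋ β ∶ A → Ren (rhoRen β) (A ∷ Θ) Θ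
Ren-rhoRen hβ here      = hβ
Ren-rhoRen hβ (there x) = x

renV-⊢ : ∀ {Γ Δ Θ M A} f → Ren f Γ Δ → Γ ⊢ M ∶ A ∣ Θ → Δ ⊢ renV f M ∶ A ∣ Θ
renV-⊢ f h (ax x)    = ax (h x)
renV-⊢ f h (lam d)   = lam (renV-⊢ (ext f) (Ren-ext h) d)
renV-⊢ f h (app d e) = app (renV-⊢ f h d) (renV-⊢ f h e)
renV-⊢ f h (nam x d) = nam x (renV-⊢ f h d)
renV-⊢ f h (mu d)    = mu (renV-⊢ f h d)

renN-⊢ : ∀ {Γ Θ Θ' M A} f → Ren f Θ Θ' → Γ ⊢ M ∶ A ∣ Θ → Γ ⊢ renN f M ∶ A ∣ Θ'
renN-⊢ f h (ax x)    = ax x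
renN-⊢ f h (lam d)   = lam (renN-⊢ f h d)
renN-⊢ f h (app d e) = app (renN-⊢ f h d) (renN-⊢ f h e)
renN-⊢ f h (nam x d) = nam (h x) (renN-⊢ f h d)
renN-⊢ f h (mu d)    = mu (renN-⊢ (ext f) (Ren-ext h) d)

Sub : (ℕ → Tm) → List Ty → List Ty → List Ty → Set
Sub σ Γ Δ Θ = ∀ {x B} → Γ ∋ x ∶ B → Δ ⊢ σ x ∶ B ∣ Θ

Sub-exts : ∀ {σ Γ Δ Θ C} → Sub σ Γ Δ Θ → Sub (exts σ) (C ∷ Γ) (C ∷ Δ) Θ
Sub-exts h here      = ax here
Sub-exts h (there x) = renV-⊢ suc there (h x)

subst-⊢ : ∀ {Γ Δ Θ M A} σ → Sub σ Γ Δ Θ → Γ ⊢ M ∶ A ∣ Θ → Δ ⊢ subst σ M ∶ A ∣ Θ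
subst-⊢ σ h (ax x)    = h x
subst-⊢ σ h (lam d)   = lam (subst-⊢ (exts σ) (Sub-exts h) d)
subst-⊢ σ h (app d e) = app (subst-⊢ σ h d) (subst-⊢ σ h e)
subst-⊢ σ h (nam x d) = nam x (subst-⊢ σ h d)
subst-⊢ σ h (mu d)    = mu (subst-⊢ (renN suc ∘ σ) (renN-⊢ suc there ∘ h) d)

AgreeExcept : ℕ → List Ty → List Ty → Set
AgreeExcept α Θ Θ' = ∀ {k T} → k ≢ α → Θ ∋ k ∶ T → Θ' ∋ k ∶ T

AgreeExcept-suc : ∀ {α Θ Θ' D} → AgreeExcept α Θ Θ' → AgreeExcept (suc α) (D ∷ Θ) (D ∷ Θ')
AgreeExcept-suc h _   here      = here
AgreeExcept-suc h k≢α (there x) = there (h (k≢α ∘ cong suc) x)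

AgreeExcept-head : ∀ {Θ D E} → AgreeExcept zero (D ∷ Θ) (E ∷ Θ)
AgreeExcept-head 0≢0 here      = ⊥-elim (0≢0 refl)
AgreeExcept-head _   (there x) = there x

substR-⊢ : ∀ {Γ Θ Θ' M C A B} α N → Θ ∋ α ∶ (A ⇒ B) → Θ' ∋ α ∶ B → AgreeExcept α Θ Θ' →
  Γ ⊢ N ∶ A ∣ Θ' → Γ ⊢ M ∶ C ∣ Θ → Γ ⊢ substR α N M ∶ C ∣ Θ'
substR-⊢ α N hα hα' agree dN (ax x)    = ax x
substR-⊢ α N hα hα' agree dN (lam d)   =
  lam (substR-⊢ α (renV suc N) hα hα' agree (renV-⊢ suc there dN) d)
substR-⊢ α N hα hα' agree dN (app d e) =
  app (substR-⊢ α N hα hα' agree dN d) (substR-⊢ α N hα hα' agree dN e)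
substR-⊢ α N hα hα' agree dN (nam {α = b} hb d) with b ≡ᵇ α | proof (b ≟ α)
... | false | ofⁿ b≢α = nam (agree b≢α hb) (substR-⊢ α N hα hα' agree dN d)
... | true  | ofʸ refl with ∋-functional hb hα
... | refl = nam hα' (app (substR-⊢ α N hα hα' agree dN d) dN)
substR-⊢ α N hα hα' agree dN (mu d)    =
  mu (substR-⊢ (suc α) (renN suc N) (there hα) (there hα') (AgreeExcept-suc agree)
               (renN-⊢ suc there dN) d)

substL-⊢ : ∀ {Γ Θ Θ' M C A B} α N → Θ ∋ α ∶ A → Θ' ∋ α ∶ B → AgreeExcept α Θ Θ' →
  Γ ⊢ N ∶ (A ⇒ B) ∣ Θ' → Γ ⊢ M ∶ C ∣ Θ → Γ ⊢ substL α N M ∶ C ∣ Θ'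
substL-⊢ α N hα hα' agree dN (ax x)    = ax x
substL-⊢ α N hα hα' agree dN (lam d)   =
  lam (substL-⊢ α (renV suc N) hα hα' agree (renV-⊢ suc there dN) d)
substL-⊢ α N hα hα' agree dN (app d e) =
  app (substL-⊢ α N hα hα' agree dN d) (substL-⊢ α N hα hα' agree dN e)
substL-⊢ α N hα hα' agree dN (nam {α = b} hb d) with b ≡ᵇ α | proof (b ≟ α)
... | false | ofⁿ b≢α = nam (agree b≢α hb) (substL-⊢ α N hα hα' agree dN d)
... | true  | ofʸ refl with ∋-functional hb hα
... | refl = nam hα' (app dN (substL-⊢ α N hα hα' agree dN d))
substL-⊢ α N hα hα' agree dN (mu d)    =
  mu (substL-⊢ (suc α) (renN suc N) (there hα) (there hα') (AgreeExcept-suc agree)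
               (renN-⊢ suc there dN) d)

DropAt : ℕ → List Ty → List Ty → Set
DropAt c Θ Θ' = ∀ {k T} → k ≢ c → Θ ∋ k ∶ T → Θ' ∋ dropIx c k ∶ T

DropAt-suc : ∀ {c Θ Θ' D} → DropAt c Θ Θ' → DropAt (suc c) (D ∷ Θ) (D ∷ Θ')
DropAt-suc h _   here      = here
DropAt-suc h k≢c (there x) = there (h (k≢c ∘ cong suc) x)

DropAt-head : ∀ {Θ D E} → DropAt zero (D ∷ E ∷ Θ) (E ∷ Θ)
DropAt-head 0≢0 here      = ⊥-elim (0≢0 refl)
DropAt-head _   (there x) = x

erase-⊢ : ∀ {Γ Θ Θ' M C} c → Θ ∋ c ∶ ⊥ty → DropAt c Θ Θ' → Γ ⊢ M ∶ C ∣ Θ → Γ ⊢ erase c M ∶ C ∣ Θ'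
erase-⊢ c hc drop (ax x)    = ax x
erase-⊢ c hc drop (lam d)   = lam (erase-⊢ c hc drop d)
erase-⊢ c hc drop (app d e) = app (erase-⊢ c hc drop d) (erase-⊢ c hc drop e)
erase-⊢ c hc drop (nam {α = b} hb d) with b ≡ᵇ c | proof (b ≟ c)
... | false | ofⁿ b≢c = nam (drop b≢c hb) (erase-⊢ c hc drop d)
... | true  | ofʸ refl with ∋-functional hb hc
... | refl = erase-⊢ c hc drop d
erase-⊢ c hc drop (mu d)    = mu (erase-⊢ (suc c) (there hc) (DropAt-suc drop) d)

↦-preserves-⊢ : ∀ {Γ Θ M M' A} → M ↦ M' → Γ ⊢ M ∶ A ∣ Θ → Γ ⊢ M' ∶ A ∣ Θ
↦-preserves-⊢ βr (app (lam dM) dN) = subst-⊢ _ (λ { here → dN ; (there x) → ax x }) dM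
↦-preserves-⊢ (μr {N = N}) (app (mu dM) dN) =
  mu (substR-⊢ zero (renN suc N) here here AgreeExcept-head (renN-⊢ suc there dN) dM)
↦-preserves-⊢ (μ'r {N = N}) (app dN (mu dM)) =
  mu (substL-⊢ zero (renN suc N) here here AgreeExcept-head (renN-⊢ suc there dN) dM)
↦-preserves-⊢ (ρr {β}) (nam hβ (mu dM)) = renN-⊢ (rhoRen β) (Ren-rhoRen hβ) dM
↦-preserves-⊢ εr (mu (mu dM)) = mu (erase-⊢ zero here DropAt-head dM)

⟶-preserves-⊢ : ∀ {Γ Θ M M' A} → M ⟶ M' → Γ ⊢ M ∶ A ∣ Θ → Γ ⊢ M' ∶ A ∣ Θ
⟶-preserves-⊢ (root r) d         = ↦-preserves-⊢ r d
⟶-preserves-⊢ (cƛ s)   (lam d)   = lam (⟶-preserves-⊢ s d)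
⟶-preserves-⊢ (c·l s)  (app d e) = app (⟶-preserves-⊢ s d) e
⟶-preserves-⊢ (c·r s)  (app d e) = app d (⟶-preserves-⊢ s e)
⟶-preserves-⊢ (cnm s)  (nam x d) = nam x (⟶-preserves-⊢ s d)
⟶-preserves-⊢ (cμ s)   (mu d)    = mu (⟶-preserves-⊢ s d)

⟶*-preserves-⊢ : ∀ {Γ Θ M M' A} → M ⟶* M' → Γ ⊢ M ∶ A ∣ Θ → Γ ⊢ M' ∶ A ∣ Θ
⟶*-preserves-⊢ ε        d = d
⟶*-preserves-⊢ (s ◅ ss) d = ⟶*-preserves-⊢ ss (⟶-preserves-⊢ s d)

⊢-fun-¬nm : ∀ {Γ Θ M A B} → Γ ⊢ M ∶ (A ⇒ B) ∣ Θ → former M ≢ `nm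
⊢-fun-¬nm (ax _)    ()
⊢-fun-¬nm (lam _)   ()
⊢-fun-¬nm (app _ _) ()
⊢-fun-¬nm (mu _)    ()

⊢⇒NamedNotApplied : ∀ {Γ Θ M A} → Γ ⊢ M ∶ A ∣ Θ → NamedNotApplied M
⊢⇒NamedNotApplied (ax _)    = avar
⊢⇒NamedNotApplied (lam d)   = aƛ (⊢⇒NamedNotApplied d)
⊢⇒NamedNotApplied (app d e) = a· (⊢⇒NamedNotApplied d) (⊢⇒NamedNotApplied e) (⊢-fun-¬nm d)
⊢⇒NamedNotApplied (nam _ d) = anm (⊢⇒NamedNotApplied d)
⊢⇒NamedNotApplied (mu d)    = aμ (⊢⇒NamedNotApplied d)

WN-Typable⇒ReducesToNf : ∀ {N} → WN N → Typable N → ReducesToNf N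
WN-Typable⇒ReducesToNf (N' , N⟶*N' , nf) (_ , _ , _ , d) =
  N' , N⟶*N' , Normal⇒Nf N' nf , ⊢⇒NamedNotApplied (⟶*-preserves-⊢ N⟶*N' d)

lemma5p12 : (x : ℕ) (Ns : List Tm) → All (λ N → WN N × Typable N) Ns →
    Typable (apps (var x) Ns) → WN (apps (var x) Ns) × Typable (apps (var x) Ns)
lemma5p12 x Ns hs t
  with HeadNf-apps (neutral nevar avar) (All.map (uncurry WN-Typable⇒ReducesToNf) hs)
... | T , xNs⟶*T , nf = (T , xNs⟶*T , Nf⇒Normal nf) , t
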